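{- Let $G$, $S$, $M$, $A,B,C,D$ be as in the context. Let $S_u$ and $S_v$ be two $D$ pairs with $uv\in E(G)$. If $\overline{u}$ has a neighbor $t\in V\setminus S$ which has a neighbor $w\in (B\cup D)\setminus(S_u\cup S_v)$, then there is a vertex $t_1\in V\setminus S$ such that $N_S(t_1)=\{u,\overline{w}\}$.
   Context: Let $G=(V,E)$ be a finite simple connected cubic graph. A paired dominating set (PDS) of $G$ is a set $S\subseteq V$ such that every vertex of $V\setminus S$ has a neighbor in $S$ and $G[S]$ has a perfect matching. Let $S$ be a PDS of minimum size and $M$ a perfect matching of $G[S]$. For $u\in S$ let $\overline{u}$ denote the vertex with $u\overline{u}\in M$, and call $S_u=\{u,\overline{u}\}$ a pair. For $x\in V\setminus S$ let $N_S(x)=N(x)\cap S$; $x$ is a private neighbor of $u\in S$ if $N_S(x)=\{u\}$. Define $A=\{v\in S: v$ and $\overline{v}$ together have at least two private neighbors$\}$, $B=\{v\in S: v$ has a private neighbor and $\overline{v}$ has none$\}$, $C=\{v\in S:\overline{v}\in B\}$, $D=\{v\in S:$ neither $v$ nor $\overline{v}$ has a private neighbor$\}$. Let $\lambda(S)$ be the number of edges of $G[S]$. The pair $(S,M)$ is chosen among all minimum PDSs and perfect matchings of their induced subgraphs so that (P1) $\lambda(S)$ is minimum, and (P2) subject to (P1), $|A\cup B|$ is minimum. A $D$ pair is a pair with both vertices in $D$. -}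

module Defs where

open import Data.Nat using (ℕ; _≤_; _<ᵇ_)
open import Data.Bool using (Bool; true; false; _∧_; _∨_; not)
open import Data.Fin using (Fin; toℕ; _≟_)
open import Data.List using (List; length; filter; map; allFin)
open import Data.Bool.ListAction using (all; any)
open import Data.Nat.ListAction using (sum)
open import Relation.Nullary.Decidable using (⌊_⌋)
open import Relation.Binary.PropositionalEquality using (_≡_)
open import Data.Product using (Σ; _×_)

_==_ : ∀ {n} → Fin n → Fin n → Bool
x == y = ⌊ x ≟ y ⌋

allV : ∀ {n} → (Fin n → Bool) → Bool
allV {n} p = all p (allFin n)

anyV : ∀ {n} → (Fin n → Bool) → Bool
anyV {n} p = any p (allFin n)

count : ∀ {n} → (Fin n → Bool) → ℕ
count {n} p = length (filter (λ x → p x ≡? true) (allFin n))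
  where
  open import Data.Bool.Properties using () renaming (_≟_ to _≡?_)

data Reach {n} (E : Fin n → Fin n → Bool) : Fin n → Fin n → Set where
  here  : ∀ {x} → Reach E x x
  there : ∀ {x y z} → E x y ≡ true → Reach E y z → Reach E x z

record CubicGraph (n : ℕ) : Set where
  field
    E         : Fin n → Fin n → Bool
    sym       : ∀ x y → E x y ≡ E y x
    irrefl    : ∀ x → E x x ≡ false
    cubic     : ∀ x → count (E x) ≡ 3
    connected : ∀ x y → Reach E x y

module _ {n} (G : CubicGraph n) where
  open CubicGraph G

  VSet : Set
  VSet = Fin n → Bool

  Dominating : VSet → Set
  Dominating S = ∀ x → S x ≡ false → anyV (λ y → S y ∧ E x y) ≡ true

  -- a perfect matching M of G[S], given as the partner map u ↦ ū
  -- (only its values on S matter)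
  IsPerfectMatching : VSet → (Fin n → Fin n) → Set
  IsPerfectMatching S m =
    ∀ v → S v ≡ true → (S (m v) ≡ true) × (E v (m v) ≡ true) × (m (m v) ≡ v)

  IsPDS : VSet → Set
  IsPDS S = Dominating S × Σ (Fin n → Fin n) (IsPerfectMatching S)

  IsMinPDS : VSet → Set
  IsMinPDS S = IsPDS S × (∀ S' → IsPDS S' → count S ≤ count S')

  edgesIn : VSet → ℕ
  edgesIn S = sum (map (λ i → count (λ j → (toℕ i <ᵇ toℕ j) ∧ S i ∧ S j ∧ E i j)) (allFin n))

  privB : VSet → Fin n → Fin n → Bool
  privB S x u = not (S x) ∧ E x u ∧ allV (λ y → not (S y ∧ E x y) ∨ (y == u))

  hasPriv : VSet → Fin n → Bool
  hasPriv S u = anyV (λ x → privB S x u)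

  inA : VSet → (Fin n → Fin n) → Fin n → Bool
  inA S m v = S v ∧ anyV (λ x → anyV (λ y →
      not (x == y) ∧ (privB S x v ∨ privB S x (m v)) ∧ (privB S y v ∨ privB S y (m v))))

  inB : VSet → (Fin n → Fin n) → Fin n → Bool
  inB S m v = S v ∧ hasPriv S v ∧ not (hasPriv S (m v))

  inC : VSet → (Fin n → Fin n) → Fin n → Bool
  inC S m v = S v ∧ inB S m (m v)

  inD : VSet → (Fin n → Fin n) → Fin n → Bool
  inD S m v = S v ∧ not (hasPriv S v) ∧ not (hasPriv S (m v))

  sizeAB : VSet → (Fin n → Fin n) → ℕ
  sizeAB S m = count (λ v → inA S m v ∨ inB S m v)

  IsChosen : VSet → (Fin n → Fin n) → Set
  IsChosen S m =
    IsMinPDS S × IsPerfectMatching S m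
    × (∀ S' → IsMinPDS S' → edgesIn S ≤ edgesIn S')
    × (∀ S' m' → IsMinPDS S' → IsPerfectMatching S' m' → edgesIn S' ≡ edgesIn S
         → sizeAB S m ≤ sizeAB S' m')

-- Pairs can be traded inside a minimum paired dominating set S: removing some
-- vertices and re-pairing gives a smaller matched set, which by minimality must
-- leave a vertex x ∉ S undominated, and N_S(x) then lies among the removed
-- vertices. Removing ū, v̄ and pairing u with v yields x₀ with N_S(x₀) ⊆ {ū, v̄},
-- and since ū, v̄ have no private neighbours, N_S(x₀) = {ū, v̄}; so t ≠ x₀ and,
-- G being cubic, N(ū) = {u, t, x₀}. Removing u, ū, w̄ and pairing t with w yields
-- x ∉ S with N_S(x) ⊆ {u, ū, w̄}; x is not adjacent to ū (it is not u, not t, and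
-- not x₀ because v̄ ∈ N_S(x₀)), and as u, w̄ have no private neighbours,
-- N_S(x) = {u, w̄}.

module Submission where

open import Defs
open import Data.Bool using (Bool; true; false; _∨_; _∧_; not)
open import Data.Bool.Properties
  using (T-≡; ¬-not; ∧-zeroʳ; ∨-zeroʳ; ∧-conicalˡ; ∧-conicalʳ) renaming (_≟_ to _≟ᵇ_)
open import Data.Fin using (Fin)
open import Data.Fin.Properties using (_≟_; any?)
open import Data.List using (List; []; _∷_; filter; length; allFin)
open import Data.List.Membership.Propositional using (_∈_)
open import Data.List.Membership.Propositional.Properties using (∈-allFin)
open import Data.List.Relation.Unary.All as All using ()
open import Data.List.Relation.Unary.All.Properties using (all⁻)
open import Data.List.Relation.Unary.AllPairs using (_∷_)
open import Data.List.Relation.Unary.Any as Any using (here; there)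
open import Data.List.Relation.Unary.Any.Properties using (any⁺; any⁻)
open import Data.List.Relation.Unary.Unique.Propositional using (Unique)
open import Data.List.Relation.Unary.Unique.Propositional.Properties using (allFin⁺)
open import Data.Nat using (ℕ; suc; _+_; _<_)
open import Data.Nat.Properties using (<⇒≱; n<1+n; m<n⇒m<1+n)
open import Data.Product using (Σ; ∃; _×_; _,_; proj₁; proj₂)
open import Data.Sum using (_⊎_; inj₁; inj₂; swap; [_,_])
open import Function using (_∘_; Equivalence)
open import Relation.Nullary using (¬_; yes; no; contradiction; Dec; ¬?; _×-dec_; _⊎-dec_)
open import Relation.Nullary.Decidable using (decidable-stable)
open import Relation.Unary using (Decidable)
open import Relation.Binary.PropositionalEquality
  using (_≡_; refl; sym; trans; cong; subst; subst₂; module ≡-Reasoning)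

not-∧-∨-false : ∀ a b {c} → not (a ∧ b) ∨ c ≡ false → a ≡ true × b ≡ true × c ≡ false
not-∧-∨-false true true c≡false = refl , refl , c≡false

module _ {A : Set} where

  countIn : (A → Bool) → List A → ℕ
  countIn p xs = length (filter (λ x → p x ≟ᵇ true) xs)

  countIn-cong : ∀ p q xs → (∀ y → y ∈ xs → p y ≡ q y) → countIn p xs ≡ countIn q xs
  countIn-cong p q []       agree = refl
  countIn-cong p q (y ∷ ys) agree with p y | q y | agree y (here refl)
  ... | true  | true  | refl = cong suc (countIn-cong p q ys (λ z → agree z ∘ there))
  ... | false | false | refl = countIn-cong p q ys (λ z → agree z ∘ there)

  countIn-differ-at : ∀ p q {x} xs → Unique xs → x ∈ xs → p x ≡ true → q x ≡ false →
                      (∀ y → ¬ y ≡ x → p y ≡ q y) → countIn p xs ≡ suc (countIn q xs)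
  countIn-differ-at p q (y ∷ ys) (y∉ys ∷ _) (here refl) px qx agree rewrite px | qx =
    cong suc (countIn-cong p q ys (λ z z∈ys → agree z (λ { refl → All.lookup y∉ys z∈ys refl })))
  countIn-differ-at p q {x} (y ∷ ys) (y∉ys ∷ unique) (there x∈ys) px qx agree
    with p y | q y | agree y (All.lookup y∉ys x∈ys)
  ... | true  | true  | refl = cong suc (countIn-differ-at p q ys unique x∈ys px qx agree)
  ... | false | false | refl = countIn-differ-at p q ys unique x∈ys px qx agree

module _ {n : ℕ} where

  count-differ-at : ∀ (p q : Fin n → Bool) {x} → p x ≡ true → q x ≡ false →
                    (∀ y → ¬ y ≡ x → p y ≡ q y) → count p ≡ suc (count q)
  count-differ-at p q {x} = countIn-differ-at p q (allFin n) (allFin⁺ n) (∈-allFin x)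

  ==-refl : (x : Fin n) → (x == x) ≡ true
  ==-refl x with x ≟ x
  ... | yes _ = refl
  ... | no x≢x = contradiction refl x≢x

  ≢⇒==-false : {x y : Fin n} → ¬ x ≡ y → (x == y) ≡ false
  ≢⇒==-false {x} {y} x≢y with x ≟ y
  ... | yes x≡y = contradiction x≡y x≢y
  ... | no _ = refl

  ==-false⇒≢ : {x y : Fin n} → (x == y) ≡ false → ¬ x ≡ y
  ==-false⇒≢ {x} x≠x refl rewrite ==-refl x = contradiction x≠x λ ()

  infixl 6 _∖_
  _∖_ : (Fin n → Bool) → Fin n → Fin n → Bool
  (p ∖ x) y = not (y == x) ∧ p y

  insert : Fin n → (Fin n → Bool) → Fin n → Bool
  insert x p y = (y == x) ∨ p y

  ∈-∖⁺ : ∀ p {x y} → ¬ y ≡ x → p y ≡ true → (p ∖ x) y ≡ true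
  ∈-∖⁺ p y≢x py rewrite ≢⇒==-false y≢x = py

  ∈-∖⁻ : ∀ {p x y} → (p ∖ x) y ≡ true → ¬ y ≡ x × p y ≡ true
  ∈-∖⁻ {p} {x} {y} h with y ≟ x | p y
  ∈-∖⁻ () | yes _ | _
  ... | no y≢x | true = y≢x , refl

  ∉-∖ : ∀ p x {y} → p y ≡ false → (p ∖ x) y ≡ false
  ∉-∖ p x {y} py rewrite py = ∧-zeroʳ (not (y == x))

  ∈-insert : ∀ x p {y} → p y ≡ true → insert x p y ≡ true
  ∈-insert x p {y} py rewrite py = ∨-zeroʳ (y == x)

  ∖-self : ∀ p x → (p ∖ x) x ≡ false
  ∖-self p x rewrite ==-refl x = refl

  ∖-other : ∀ p {x y} → ¬ y ≡ x → p y ≡ (p ∖ x) y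
  ∖-other p y≢x rewrite ≢⇒==-false y≢x = refl

  insert-self : ∀ p x → insert x p x ≡ true
  insert-self p x rewrite ==-refl x = refl

  insert-other : ∀ p {x y} → ¬ y ≡ x → insert x p y ≡ p y
  insert-other p y≢x rewrite ≢⇒==-false y≢x = refl

  count-∖ : ∀ p x → p x ≡ true → count p ≡ suc (count (p ∖ x))
  count-∖ p x px = count-differ-at p (p ∖ x) px (∖-self p x) (λ y → ∖-other p)

  count-insert : ∀ p x → p x ≡ false → count (insert x p) ≡ suc (count p)
  count-insert p x px = count-differ-at (insert x p) p (insert-self p x) px (λ y → insert-other p)

  anyV-intro : ∀ (p : Fin n → Bool) {x} → p x ≡ true → anyV p ≡ true
  anyV-intro p {x} px = Equivalence.to T-≡
    (any⁺ p (Any.map (λ { refl → Equivalence.from T-≡ px }) (∈-allFin x)))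

  anyV-elim : ∀ (p : Fin n → Bool) → anyV p ≡ true → ∃ λ x → p x ≡ true
  anyV-elim p some with Any.satisfied (any⁻ p (allFin n) (Equivalence.from T-≡ some))
  ... | x , px = x , Equivalence.to T-≡ px

  anyV-false : ∀ (p : Fin n → Bool) {x} → anyV p ≡ false → p x ≡ false
  anyV-false p {x} none with p x in px
  ... | false = refl
  ... | true  = contradiction (trans (sym (anyV-intro p px)) none) λ ()

  allV-false : ∀ (p : Fin n → Bool) → allV p ≡ false → ∃ λ x → p x ≡ false
  allV-false p notAll with any? (λ x → p x ≟ᵇ false)
  ... | yes found = found
  ... | no  none  = contradiction (trans (sym everywhere) notAll) λ ()
    where
    everywhere : allV p ≡ true
    everywhere = Equivalence.to T-≡ (all⁻ p {allFin n} (All.tabulate λ {x} _ →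
      Equivalence.from T-≡ (¬-not (λ px → none (x , px)))))

  rematch : (Fin n → Fin n) → Fin n → Fin n → Fin n → Fin n
  rematch m a b y with y ≟ a | y ≟ b
  ... | yes _ | _     = b
  ... | no _  | yes _ = a
  ... | no _  | no _  = m y

  rematch-left : ∀ m a b → rematch m a b a ≡ b
  rematch-left m a b with a ≟ a
  ... | yes _ = refl
  ... | no a≢a = contradiction refl a≢a

  rematch-right : ∀ m {a b} → ¬ b ≡ a → rematch m a b b ≡ a
  rematch-right m {a} {b} b≢a with b ≟ a | b ≟ b
  ... | yes b≡a | _     = contradiction b≡a b≢a
  ... | no _    | yes _ = refl
  ... | no _    | no b≢b = contradiction refl b≢b

  rematch-other : ∀ m {a b y} → ¬ y ≡ a → ¬ y ≡ b → rematch m a b y ≡ m y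
  rematch-other m {a} {b} {y} y≢a y≢b with y ≟ a | y ≟ b
  ... | yes y≡a | _       = contradiction y≡a y≢a
  ... | no _    | yes y≡b = contradiction y≡b y≢b
  ... | no _    | no _    = refl

  ∈∉⇒≢ : ∀ {p : Fin n → Bool} {y z} → p y ≡ true → p z ≡ false → ¬ y ≡ z
  ∈∉⇒≢ py pz refl = contradiction (trans (sym py) pz) λ ()

module _ {n} (G : CubicGraph n) where
  open CubicGraph G renaming (sym to E-sym)

  adjacent⇒≢ : ∀ {x y} → E x y ≡ true → ¬ x ≡ y
  adjacent⇒≢ {x} Exx refl = contradiction (trans (sym Exx) (irrefl x)) λ ()

  at-most-three-neighbours : ∀ {a b c d z} → ¬ b ≡ c → ¬ b ≡ d → ¬ c ≡ d →
    E a b ≡ true → E a c ≡ true → E a d ≡ true → E a z ≡ true → z ≡ b ⊎ z ≡ c ⊎ z ≡ d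
  at-most-three-neighbours {a} {b} {c} {d} {z} b≢c b≢d c≢d Eab Eac Ead Eaz
    with z ≟ b | z ≟ c | z ≟ d
  ... | yes z≡b | _       | _       = inj₁ z≡b
  ... | no _    | yes z≡c | _       = inj₂ (inj₁ z≡c)
  ... | no _    | no _    | yes z≡d = inj₂ (inj₂ z≡d)
  ... | no z≢b  | no z≢c  | no z≢d  = contradiction (trans (sym (cubic a)) four-plus) λ ()
    where
    open ≡-Reasoning
    four-plus : count (E a) ≡ 4 + count (E a ∖ b ∖ c ∖ d ∖ z)
    four-plus = begin
      count (E a)
        ≡⟨ count-∖ (E a) b Eab ⟩
      suc (count (E a ∖ b))
        ≡⟨ cong suc (count-∖ (E a ∖ b) c (∈-∖⁺ (E a) (b≢c ∘ sym) Eac)) ⟩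
      suc (suc (count (E a ∖ b ∖ c)))
        ≡⟨ cong (suc ∘ suc) (count-∖ (E a ∖ b ∖ c) d
             (∈-∖⁺ (E a ∖ b) (c≢d ∘ sym) (∈-∖⁺ (E a) (b≢d ∘ sym) Ead))) ⟩
      suc (suc (suc (count (E a ∖ b ∖ c ∖ d))))
        ≡⟨ cong (suc ∘ suc ∘ suc) (count-∖ (E a ∖ b ∖ c ∖ d) z
             (∈-∖⁺ (E a ∖ b ∖ c) z≢d (∈-∖⁺ (E a ∖ b) z≢c (∈-∖⁺ (E a) z≢b Eaz)))) ⟩
      suc (suc (suc (suc (count (E a ∖ b ∖ c ∖ d ∖ z)))))
        ∎

  Dominated : VSet G → Fin n → Set
  Dominated S x = anyV (λ y → S y ∧ E x y) ≡ true

  dominated? : ∀ S x → Dec (Dominated S x)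
  dominated? S x = anyV (λ y → S y ∧ E x y) ≟ᵇ true

  dominated-by : ∀ S {x y} → S y ≡ true → E x y ≡ true → Dominated S x
  dominated-by S {x} {y} Sy Exy = anyV-intro (λ y → S y ∧ E x y) {y} lemma
    where
    lemma : S y ∧ E x y ≡ true
    lemma rewrite Sy = Exy

  dominator : ∀ S {x} → Dominated S x → ∃ λ y → S y ≡ true × E x y ≡ true
  dominator S {x} dom with anyV-elim _ dom
  ... | y , SEy = y , ∧-conicalˡ (S y) _ SEy , ∧-conicalʳ (S y) _ SEy

  DominatorsWithin : VSet G → Fin n → (Fin n → Set) → Set
  DominatorsWithin S x R = ∀ y → S y ≡ true → E x y ≡ true → R y

  DominatedExactlyBy : VSet G → Fin n → Fin n → Fin n → Set
  DominatedExactlyBy S x a b = S x ≡ false × E x a ≡ true × E x b ≡ true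
                             × DominatorsWithin S x (λ y → y ≡ a ⊎ y ≡ b)

  other-dominator : ∀ {S a x} → hasPriv G S a ≡ false → S x ≡ false → E x a ≡ true →
                    ∃ λ y → S y ≡ true × E x y ≡ true × ¬ y ≡ a
  other-dominator {S} {a} {x} noPriv Sx Exa
    with allV-false _ (last-conjunct-false Sx Exa (anyV-false (λ x → privB G S x a) noPriv))
    where
    last-conjunct-false : ∀ {s e c} → s ≡ false → e ≡ true → not s ∧ e ∧ c ≡ false → c ≡ false
    last-conjunct-false refl refl c≡false = c≡false
  ... | y , outside with not-∧-∨-false (S y) (E x y) outside
  ... | Sy , Exy , y≠a = y , Sy , Exy , ==-false⇒≢ y≠a

  second-dominator : ∀ {S a b x} → hasPriv G S a ≡ false → S x ≡ false →
                      DominatorsWithin S x (λ y → y ≡ a ⊎ y ≡ b) → E x a ≡ true → E x b ≡ true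
  second-dominator noPriv Sx within Exa with other-dominator noPriv Sx Exa
  ... | y , Sy , Exy , y≢a with within y Sy Exy
  ...   | inj₁ y≡a = contradiction y≡a y≢a
  ...   | inj₂ refl = Exy

  dominated-exactly-by : ∀ {S a b x} → Dominating G S →
    hasPriv G S a ≡ false → hasPriv G S b ≡ false → S x ≡ false →
    DominatorsWithin S x (λ y → y ≡ a ⊎ y ≡ b) → DominatedExactlyBy S x a b
  dominated-exactly-by {S} {a} {b} {x} dominating noPriv-a noPriv-b Sx within
    with dominator S (dominating x Sx)
  ... | y , Sy , Exy with within y Sy Exy
  ...   | inj₁ refl = Sx , Exy , second-dominator noPriv-a Sx within Exy , within
  ...   | inj₂ refl = Sx , second-dominator noPriv-b Sx within′ Exy , Exy , within
    where
    within′ : DominatorsWithin S x (λ z → z ≡ b ⊎ z ≡ a)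
    within′ z Sz Exz = swap (within z Sz Exz)

  module _ {S : VSet G} (minimum : IsMinPDS G S) where

    smaller-matched-set⇒undominated-vertex : ∀ {S' m'} {R : Fin n → Set} → Decidable R →
      IsPerfectMatching G S' m' → count S' < count S →
      (∀ y → S y ≡ true → ¬ R y → S' y ≡ true) → (∀ y → R y → Dominated S' y) →
      ∃ λ x → S x ≡ false × S' x ≡ false × DominatorsWithin S x R
    smaller-matched-set⇒undominated-vertex {S'} {m'} {R} R? matching smaller keeps R-dominated
      with any? (λ x → (S' x ≟ᵇ false) ×-dec ¬? (dominated? S' x))
    ... | no none = contradiction (proj₂ minimum S' (dominating , m' , matching)) (<⇒≱ smaller)
      where
      dominating : Dominating G S'
      dominating x S'x =
        decidable-stable (dominated? S' x) (λ undominated → none (x , S'x , undominated))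
    ... | yes (x , S'x , undominated) = x , ¬-not Sx≢true , S'x , within
      where
      Sx≢true : ¬ S x ≡ true
      Sx≢true Sx with R? x
      ... | yes Rx = undominated (R-dominated x Rx)
      ... | no ¬Rx = contradiction (trans (sym (keeps x Sx ¬Rx)) S'x) λ ()
      within : DominatorsWithin S x R
      within y Sy Exy =
        decidable-stable (R? y) (λ ¬Ry → undominated (dominated-by S' (keeps y Sy ¬Ry) Exy))

  rematch-isPerfectMatching : ∀ {S S' m a b} → IsPerfectMatching G S m → E a b ≡ true →
    S' a ≡ true → S' b ≡ true →
    (∀ y → S' y ≡ true → ¬ y ≡ a → ¬ y ≡ b → S y ≡ true × S' (m y) ≡ true × ¬ m y ≡ a × ¬ m y ≡ b) →
    IsPerfectMatching G S' (rematch m a b)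
  rematch-isPerfectMatching {S} {S'} {m} {a} {b} matching Eab S'a S'b rest y S'y =
    cases y S'y (y ≟ a) (y ≟ b)
    where
    m′ = rematch m a b
    MatchedAt : Fin n → Set
    MatchedAt y = S' (m′ y) ≡ true × E y (m′ y) ≡ true × m′ (m′ y) ≡ y
    matched-to : ∀ {y z} → m′ y ≡ z → S' z ≡ true → E y z ≡ true → m′ z ≡ y → MatchedAt y
    matched-to refl S'z Eyz m′z≡y = S'z , Eyz , m′z≡y
    cases : ∀ y → S' y ≡ true → Dec (y ≡ a) → Dec (y ≡ b) → MatchedAt y
    cases .a _ (yes refl) _ =
      matched-to (rematch-left m a b) S'b Eab (rematch-right m (adjacent⇒≢ Eab ∘ sym))
    cases .b _ (no b≢a) (yes refl) =
      matched-to (rematch-right m b≢a) S'a (trans (E-sym b a) Eab) (rematch-left m a b)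
    cases y S'y (no y≢a) (no y≢b) with rest y S'y y≢a y≢b
    ... | Sy , S'my , my≢a , my≢b with matching y Sy
    ...   | _ , Eymy , mmy≡y =
      matched-to (rematch-other m y≢a y≢b) S'my Eymy (trans (rematch-other m my≢a my≢b) mmy≡y)

  inD⇒noPrivate : ∀ {S m v} → inD G S m v ≡ true →
                  S v ≡ true × hasPriv G S v ≡ false × hasPriv G S (m v) ≡ false
  inD⇒noPrivate {S} {m} {v} h with S v | hasPriv G S v | hasPriv G S (m v)
  ... | true | false | false = refl , refl , refl

  inB∨inD⇒partner-noPrivate : ∀ {S m w} → (inB G S m w ∨ inD G S m w) ≡ true →
                              S w ≡ true × hasPriv G S (m w) ≡ false
  inB∨inD⇒partner-noPrivate {S} {m} {w} h with S w | hasPriv G S w | hasPriv G S (m w)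
  ... | true | _     | false = refl , refl
  inB∨inD⇒partner-noPrivate () | true | true  | true
  inB∨inD⇒partner-noPrivate () | true | false | true

  module _ {S : VSet G} {m : Fin n → Fin n}
           (minimum : IsMinPDS G S) (matching : IsPerfectMatching G S m) where

    private
      dominating : Dominating G S
      dominating = proj₁ (proj₁ minimum)

      partner-∈ : ∀ {y} → S y ≡ true → S (m y) ≡ true
      partner-∈ Sy = proj₁ (matching _ Sy)

      partner-adjacent : ∀ {y} → S y ≡ true → E y (m y) ≡ true
      partner-adjacent Sy = proj₁ (proj₂ (matching _ Sy))

      partner-adjacent′ : ∀ {y} → S y ≡ true → E (m y) y ≡ true
      partner-adjacent′ {y} Sy = trans (E-sym (m y) y) (partner-adjacent Sy)

      partner-involutive : ∀ {y} → S y ≡ true → m (m y) ≡ y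
      partner-involutive Sy = proj₂ (proj₂ (matching _ Sy))

      partner-≢ : ∀ {y z} → S y ≡ true → ¬ y ≡ m z → ¬ m y ≡ z
      partner-≢ Sy y≢mz refl = y≢mz (sym (partner-involutive Sy))

      partners-≢ : ∀ {y z} → S y ≡ true → S z ≡ true → ¬ y ≡ z → ¬ m y ≡ m z
      partners-≢ Sy Sz y≢z my≡mz =
        y≢z (trans (sym (partner-involutive Sy)) (trans (cong m my≡mz) (partner-involutive Sz)))

    adjacent-pairs⇒partners-dominate-exactly : ∀ {u v} → S u ≡ true → S v ≡ true →
      E u v ≡ true → ¬ v ≡ m u → hasPriv G S (m u) ≡ false → hasPriv G S (m v) ≡ false →
      ∃ λ x → DominatedExactlyBy S x (m u) (m v)
    adjacent-pairs⇒partners-dominate-exactly {u} {v} Su Sv Euv v≢mu noPriv-mu noPriv-mv =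
      let x , Sx , _ , within = smaller-matched-set⇒undominated-vertex minimum R?
                                  (rematch-isPerfectMatching matching Euv S'u S'v rest)
                                  smaller keeps R-dominated
      in x , dominated-exactly-by dominating noPriv-mu noPriv-mv Sx within
      where
      S' = S ∖ m u ∖ m v
      R : Fin n → Set
      R y = y ≡ m u ⊎ y ≡ m v
      R? : Decidable R
      R? y = (y ≟ m u) ⊎-dec (y ≟ m v)
      keeps : ∀ y → S y ≡ true → ¬ R y → S' y ≡ true
      keeps y Sy ¬Ry = ∈-∖⁺ (S ∖ m u) (¬Ry ∘ inj₂) (∈-∖⁺ S (¬Ry ∘ inj₁) Sy)
      S'u : S' u ≡ true
      S'u = keeps u Su [ adjacent⇒≢ (partner-adjacent Su) , partner-≢ Sv v≢mu ∘ sym ]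
      S'v : S' v ≡ true
      S'v = keeps v Sv [ v≢mu , adjacent⇒≢ (partner-adjacent Sv) ]
      rest : ∀ y → S' y ≡ true → ¬ y ≡ u → ¬ y ≡ v →
             S y ≡ true × S' (m y) ≡ true × ¬ m y ≡ u × ¬ m y ≡ v
      rest y S'y y≢u y≢v with ∈-∖⁻ {p = S ∖ m u} S'y
      ... | y≢mv , S∖mu-y with ∈-∖⁻ {p = S} S∖mu-y
      ...   | y≢mu , Sy =
        Sy , keeps (m y) (partner-∈ Sy) [ partners-≢ Sy Su y≢u , partners-≢ Sy Sv y≢v ]
           , partner-≢ Sy y≢mu , partner-≢ Sy y≢mv
      smaller : count S' < count S
      smaller = subst (count S' <_) (sym two-removed) (m<n⇒m<1+n (n<1+n _))
        where
        two-removed : count S ≡ suc (suc (count S'))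
        two-removed = trans (count-∖ S (m u) (partner-∈ Su))
          (cong suc (count-∖ (S ∖ m u) (m v)
            (∈-∖⁺ S (partners-≢ Sv Su (adjacent⇒≢ Euv ∘ sym)) (partner-∈ Sv))))
      R-dominated : ∀ y → R y → Dominated S' y
      R-dominated _ (inj₁ refl) = dominated-by S' S'u (partner-adjacent′ Su)
      R-dominated _ (inj₂ refl) = dominated-by S' S'v (partner-adjacent′ Sv)

    outside-neighbour-of-partner⇒undominated-vertex : ∀ {u v t w} →
      S u ≡ true → S v ≡ true → E u v ≡ true → ¬ v ≡ m u →
      S t ≡ false → E (m u) t ≡ true → S w ≡ true → E t w ≡ true →
      ¬ w ≡ u → ¬ w ≡ m u → ¬ w ≡ m v →
      ∃ λ x → S x ≡ false × ¬ x ≡ t × DominatorsWithin S x (λ y → y ≡ u ⊎ y ≡ m u ⊎ y ≡ m w)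
    outside-neighbour-of-partner⇒undominated-vertex {u} {v} {t} {w}
      Su Sv Euv v≢mu St Emut Sw Etw w≢u w≢mu w≢mv =
      let x , Sx , S'x , within = smaller-matched-set⇒undominated-vertex minimum R?
                                    (rematch-isPerfectMatching matching Etw S't S'w rest)
                                    smaller keeps R-dominated
      in x , Sx , ∈∉⇒≢ {p = S'} S't S'x ∘ sym , within
      where
      S₃ = S ∖ u ∖ m u ∖ m w
      S' = insert t S₃
      R : Fin n → Set
      R y = y ≡ u ⊎ y ≡ m u ⊎ y ≡ m w
      R? : Decidable R
      R? y = (y ≟ u) ⊎-dec (y ≟ m u) ⊎-dec (y ≟ m w)
      keeps₃ : ∀ y → S y ≡ true → ¬ R y → S₃ y ≡ true
      keeps₃ y Sy ¬Ry = ∈-∖⁺ (S ∖ u ∖ m u) (¬Ry ∘ inj₂ ∘ inj₂)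
        (∈-∖⁺ (S ∖ u) (¬Ry ∘ inj₂ ∘ inj₁) (∈-∖⁺ S (¬Ry ∘ inj₁) Sy))
      keeps : ∀ y → S y ≡ true → ¬ R y → S' y ≡ true
      keeps y Sy ¬Ry = ∈-insert t S₃ {y} (keeps₃ y Sy ¬Ry)
      S't : S' t ≡ true
      S't = insert-self S₃ t
      S'w : S' w ≡ true
      S'w = keeps w Sw [ w≢u , [ w≢mu , adjacent⇒≢ (partner-adjacent Sw) ] ]
      S'v : S' v ≡ true
      S'v = keeps v Sv [ adjacent⇒≢ Euv ∘ sym , [ v≢mu , partner-≢ Sw w≢mv ∘ sym ] ]
      rest : ∀ y → S' y ≡ true → ¬ y ≡ t → ¬ y ≡ w →
             S y ≡ true × S' (m y) ≡ true × ¬ m y ≡ t × ¬ m y ≡ w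
      rest y S'y y≢t y≢w
        with ∈-∖⁻ {p = S ∖ u ∖ m u} {y = y} (trans (sym (insert-other S₃ {y = y} y≢t)) S'y)
      ... | y≢mw , S∖u∖mu-y with ∈-∖⁻ {p = S ∖ u} S∖u∖mu-y
      ...   | y≢mu , S∖u-y with ∈-∖⁻ {p = S} S∖u-y
      ...     | y≢u , Sy =
        Sy , keeps (m y) (partner-∈ Sy)
               [ partner-≢ Sy y≢mu , [ partners-≢ Sy Su y≢u , partners-≢ Sy Sw y≢w ] ]
           , ∈∉⇒≢ (partner-∈ Sy) St , partner-≢ Sy y≢mw
      smaller : count S' < count S
      smaller = subst₂ _<_ (sym one-added) (sym three-removed) (m<n⇒m<1+n (n<1+n _))
        where
        three-removed : count S ≡ suc (suc (suc (count S₃)))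
        three-removed = trans (count-∖ S u Su) (cong suc (trans
          (count-∖ (S ∖ u) (m u) (∈-∖⁺ S (adjacent⇒≢ (partner-adjacent Su) ∘ sym) (partner-∈ Su)))
          (cong suc (count-∖ (S ∖ u ∖ m u) (m w)
            (∈-∖⁺ (S ∖ u) (partners-≢ Sw Su w≢u) (∈-∖⁺ S (partner-≢ Sw w≢mu) (partner-∈ Sw)))))))
        one-added : count S' ≡ suc (count S₃)
        one-added = count-insert S₃ t (∉-∖ (S ∖ u ∖ m u) (m w) {t} (∉-∖ (S ∖ u) (m u) (∉-∖ S u St)))
      R-dominated : ∀ y → R y → Dominated S' y
      R-dominated _ (inj₁ refl)        = dominated-by S' S'v Euv
      R-dominated _ (inj₂ (inj₁ refl)) = dominated-by S' S't Emut
      R-dominated _ (inj₂ (inj₂ refl)) = dominated-by S' S'w (partner-adjacent′ Sw)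

    partner-outside-neighbour⇒dominated-exactly : ∀ {u v t w x₀} →
      S u ≡ true → hasPriv G S u ≡ false → S v ≡ true → E u v ≡ true → ¬ v ≡ m u →
      DominatedExactlyBy S x₀ (m u) (m v) →
      S t ≡ false → E (m u) t ≡ true → S w ≡ true → hasPriv G S (m w) ≡ false → E t w ≡ true →
      ¬ w ≡ u → ¬ w ≡ m u → ¬ w ≡ v → ¬ w ≡ m v →
      ∃ λ x → DominatedExactlyBy S x u (m w)
    partner-outside-neighbour⇒dominated-exactly {u} {v} {t} {w} {x₀}
      Su noPriv-u Sv Euv v≢mu (Sx₀ , Ex₀mu , Ex₀mv , x₀-within)
      St Emut Sw noPriv-mw Etw w≢u w≢mu w≢v w≢mv
      = let x , Sx , x≢t , within = outside-neighbour-of-partner⇒undominated-vertex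
                                      Su Sv Euv v≢mu St Emut Sw Etw w≢u w≢mu w≢mv
        in x , dominated-exactly-by dominating noPriv-u noPriv-mw Sx (narrowed Sx x≢t within)
      where
      t≢x₀ : ¬ t ≡ x₀
      t≢x₀ t≡x₀ = [ w≢mu , w≢mv ] (x₀-within w Sw (subst (λ z → E z w ≡ true) t≡x₀ Etw))
      mv-outside : ¬ (m v ≡ u ⊎ m v ≡ m u ⊎ m v ≡ m w)
      mv-outside = [ partner-≢ Sv v≢mu
                   , [ partners-≢ Sv Su (adjacent⇒≢ Euv ∘ sym) , partners-≢ Sv Sw (w≢v ∘ sym) ] ]
      narrowed : ∀ {x} → S x ≡ false → ¬ x ≡ t →
                 DominatorsWithin S x (λ y → y ≡ u ⊎ y ≡ m u ⊎ y ≡ m w) →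
                 DominatorsWithin S x (λ y → y ≡ u ⊎ y ≡ m w)
      narrowed {x} Sx x≢t within y Sy Exy with within y Sy Exy
      ... | inj₁ y≡u         = inj₁ y≡u
      ... | inj₂ (inj₂ y≡mw) = inj₂ y≡mw
      ... | inj₂ (inj₁ refl) with at-most-three-neighbours (∈∉⇒≢ Su St) (∈∉⇒≢ Su Sx₀) t≢x₀
            (partner-adjacent′ Su) Emut (trans (E-sym (m u) x₀) Ex₀mu) (trans (E-sym (m u) x) Exy)
      ...   | inj₁ x≡u         = contradiction (sym x≡u) (∈∉⇒≢ Su Sx)
      ...   | inj₂ (inj₁ x≡t)  = contradiction x≡t x≢t
      ...   | inj₂ (inj₂ refl) = contradiction (within (m v) (partner-∈ Sv) Ex₀mv) mv-outside

lemma8 : ∀ {n} (G : CubicGraph n) (S : Fin n → Bool) (m : Fin n → Fin n) →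
    IsChosen G S m →
    ∀ (u v t w : Fin n) →
    -- S_u and S_v are two (distinct) D pairs with uv ∈ E(G)
    inD G S m u ≡ true → inD G S m (m u) ≡ true →
    inD G S m v ≡ true → inD G S m (m v) ≡ true →
    ¬ (v ≡ m u) → CubicGraph.E G u v ≡ true →
    -- t ∈ V ∖ S is a neighbour of ū
    S t ≡ false → CubicGraph.E G (m u) t ≡ true →
    -- w ∈ (B ∪ D) ∖ (S_u ∪ S_v) is a neighbour of t
    CubicGraph.E G t w ≡ true →
    (inB G S m w ∨ inD G S m w) ≡ true →
    ¬ (w ≡ u) → ¬ (w ≡ m u) → ¬ (w ≡ v) → ¬ (w ≡ m v) →
    -- conclusion: some t₁ ∈ V ∖ S has N_S(t₁) = {u, w̄}
    Σ (Fin n) (λ t₁ → (S t₁ ≡ false)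
      × (CubicGraph.E G t₁ u ≡ true) × (CubicGraph.E G t₁ (m w) ≡ true)
      × (∀ y → S y ≡ true → CubicGraph.E G t₁ y ≡ true → (y ≡ u) ⊎ (y ≡ m w)))
lemma8 G S m (minimum , matching , _) u v t w Du _ Dv _ v≢mu Euv St Emut Etw BDw w≢u w≢mu w≢v w≢mv
  with inD⇒noPrivate G {S} {m} {u} Du | inD⇒noPrivate G {S} {m} {v} Dv
     | inB∨inD⇒partner-noPrivate G {S} {m} {w} BDw
... | Su , noPriv-u , noPriv-mu | Sv , _ , noPriv-mv | Sw , noPriv-mw
  with adjacent-pairs⇒partners-dominate-exactly G minimum matching
         Su Sv Euv v≢mu noPriv-mu noPriv-mv
... | x₀ , x₀-exact =
  partner-outside-neighbour⇒dominated-exactly G minimum matching Su noPriv-u Sv Euv v≢mu x₀-exact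
    St Emut Sw noPriv-mw Etw w≢u w≢mu w≢v w≢mv
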